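{- If $H_1 = ((V,W),E_1)$ is a bi-regular $(\delta,\epsilon)$-extractor, and if $H_2 = ((W,X),E_2)$ is a bi-regular $\lambda$-expander, then the product graph $H_1 \cdot H_2$ is a $(\delta,\epsilon, \lambda^2\epsilon/\delta)$-fortifier.
   Context: A bipartite graph $H=((P,Q),E)$ is a $(\delta,\epsilon)$-extractor if for every $S\subseteq P$ with $|S|\ge\delta|P|$, the distribution $\pi$ on $Q$ obtained by picking a uniformly random element of $S$ and then a uniformly random neighbour satisfies $|\pi-u_Q|_1\le\epsilon$, where $u_Q$ denotes the uniform distribution on $Q$. A bipartite graph $H=((W,X),E_H)$ is a $(\delta,\epsilon_1,\epsilon_2)$-fortifier if for every $S\subseteq W$ with $|S|\ge\delta|W|$, the distribution $\pi$ on $X$ induced by a uniformly random $w\in S$ followed by a uniformly random neighbour of $w$ satisfies $|\pi-u_X|_1\le\epsilon_1$ and $\|\pi-u_X\|^2\le \epsilon_2/|X|$, where $u_X$ is the uniform distribution on $X$. For a bi-regular bipartite graph $H=((P,Q),E)$ with left degree $D$, let $H$ also denote the $|Q|\times|P|$ matrix with $H(q,p)=1/D$ if $(p,q)\in E$ and $0$ otherwise; then $\lambda(H)=\max_{v\perp u_P}\frac{\|Hv\|}{\|v\|}\cdot\frac{\|u_P\|}{\|Hu_P\|}$, and $H$ is a $\lambda$-expander if $\lambda(H)\le\lambda$. The product graph $H_1\cdot H_2$ is the bipartite graph between $V$ and $X$ corresponding to a two-step walk $V\to W\to X$ (random neighbour in $H_1$, then random neighbour in $H_2$).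
   Formalization: The parameters δ, ε and λ are rational, and the vectors $v\perp u_P$ in the definition of $\lambda(H)$ are taken with rational entries. -}

module Defs where

open import Data.Nat as ℕ using (ℕ; zero; suc)
open import Data.Integer using (+_)
open import Data.Fin using (Fin; zero; suc)
open import Data.Bool using (Bool; true; false; if_then_else_)
open import Data.Vec using (lookup)
open import Data.Fin.Subset using (Subset) renaming (∣_∣ to card)
open import Data.Rational using (ℚ; 0ℚ; _+_; _*_; _-_; _≤_; _<_; _/_) renaming (∣_∣ to abs)
open import Data.Product using (_×_; Σ)
open import Relation.Binary.PropositionalEquality using (_≡_)

sumℚ : (n : ℕ) → (Fin n → ℚ) → ℚ
sumℚ zero    f = 0ℚ
sumℚ (suc n) f = f zero + sumℚ n (λ i → f (suc i))

countB : (n : ℕ) → (Fin n → Bool) → ℕ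
countB zero    f = 0
countB (suc n) f = (if f zero then 1 else 0) ℕ.+ countB n (λ i → f (suc i))

-- natural number as rational, and 1/n (with the harmless convention 1/0 = 0,
-- only ever used where the argument is nonzero)
toℚ : ℕ → ℚ
toℚ n = (+ n) / 1

inv : ℕ → ℚ
inv zero    = 0ℚ
inv (suc n) = (+ 1) / (suc n)

BipGraph : ℕ → ℕ → Set
BipGraph p q = Fin p → Fin q → Bool

degL : ∀ {p q} → BipGraph p q → Fin p → ℕ
degL {p} {q} E a = countB q (λ b → E a b)

degR : ∀ {p q} → BipGraph p q → Fin q → ℕ
degR {p} {q} E b = countB p (λ a → E a b)

IsBiRegular : ∀ {p q} → BipGraph p q → Set
IsBiRegular {p} {q} E =
  Σ ℕ λ D → Σ ℕ λ D' → (1 ℕ.≤ D) × (1 ℕ.≤ D') ×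
    ((a : Fin p) → degL E a ≡ D) × ((b : Fin q) → degR E b ≡ D')

-- one-step random-walk kernel: K a b = probability of moving from a to b
Kernel : ℕ → ℕ → Set
Kernel p q = Fin p → Fin q → ℚ

graphKernel : ∀ {p q} → BipGraph p q → Kernel p q
graphKernel E a b = if E a b then inv (degL E a) else 0ℚ

composeK : ∀ {p w q} → Kernel p w → Kernel w q → Kernel p q
composeK {p} {w} {q} K₁ K₂ a c = sumℚ w (λ b → K₁ a b * K₂ b c)

-- the product graph H₁ · H₂ (as its two-step walk)
productKernel : ∀ {v w x} → BipGraph v w → BipGraph w x → Kernel v x
productKernel E₁ E₂ = composeK (graphKernel E₁) (graphKernel E₂)

walkDist : ∀ {p q} → Kernel p q → Subset p → Fin q → ℚ
walkDist {p} {q} K S b =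
  inv (card S) * sumℚ p (λ a → if lookup S a then K a b else 0ℚ)

l1dist : ∀ {q} → (Fin q → ℚ) → ℚ
l1dist {q} π = sumℚ q (λ b → abs (π b - inv q))

l2distSq : ∀ {q} → (Fin q → ℚ) → ℚ
l2distSq {q} π = sumℚ q (λ b → (π b - inv q) * (π b - inv q))

IsExtractorK : ∀ {p q} → Kernel p q → ℚ → ℚ → Set
IsExtractorK {p} {q} K δ ε =
  (S : Subset p) → 1 ℕ.≤ card S → δ * toℚ p ≤ toℚ (card S) →
    l1dist (walkDist K S) ≤ ε

IsExtractor : ∀ {p q} → BipGraph p q → ℚ → ℚ → Set
IsExtractor E δ ε = IsExtractorK (graphKernel E) δ ε

IsFortifierK : ∀ {p q} → Kernel p q → ℚ → ℚ → ℚ → Set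
IsFortifierK {p} {q} K δ ε₁ ε₂ =
  (S : Subset p) → 1 ℕ.≤ card S → δ * toℚ p ≤ toℚ (card S) →
    (l1dist (walkDist K S) ≤ ε₁) × (l2distSq (walkDist K S) ≤ ε₂ * inv q)

-- the normalised matrix H(q,p) = 1/D on edges, applied to a vector on P
applyH : ∀ {p q} → BipGraph p q → (Fin p → ℚ) → Fin q → ℚ
applyH {p} {q} E v b = sumℚ p (λ a → graphKernel E a b * v a)

normSq : ∀ {n} → (Fin n → ℚ) → ℚ
normSq {n} v = sumℚ n (λ i → v i * v i)

uniformVec : (n : ℕ) → Fin n → ℚ
uniformVec n _ = inv n

-- λ(H) ≤ λ, i.e. for all v ⊥ u_P:  (‖Hv‖/‖v‖)·(‖u_P‖/‖Hu_P‖) ≤ λ,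
-- written without square roots: the ratio is ≥ 0, so (for v ≠ 0) this is
-- 0 ≤ λ together with the squared inequality (cleared of denominators).
IsExpander : ∀ {p q} → BipGraph p q → ℚ → Set
IsExpander {p} {q} E λ' =
  (v : Fin p → ℚ) → sumℚ p v ≡ 0ℚ →
    (0ℚ < normSq v → 0ℚ ≤ λ') ×
    (normSq (applyH E v) * normSq (uniformVec p)
       ≤ (λ' * λ') * (normSq v * normSq (applyH E (uniformVec p))))

module Submission where

-- Let π₁ be the distribution on W obtained from a uniform element of S by one
-- step of H₁, and π the distribution on X after a further step of H₂, so that
-- π = H₂π₁.  Bi-regularity of H₂ makes its walk operator send u_W to u_X, hence
-- the deviation d = π₁ − u_W is carried to π − u_X = H₂d.
--   * ℓ₁: a stochastic kernel does not increase ℓ₁-norms, so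
--     |π − u_X|₁ ≤ |π₁ − u_W|₁ ≤ ε by the extractor property of H₁.
--   * ℓ₂: the expander bound gives ‖H₂d‖²·(1/|W|) ≤ λ²‖d‖²·(1/|X|).  The columns
--     of H₁ sum to |V|/|W| and |S| ≥ δ|V|, so every coordinate of π₁ and of u_W
--     lies in [0, 1/(δ|W|)]; hence ‖d‖²·δ|W| ≤ |d|₁ ≤ ε, and ‖π − u_X‖² ≤ λ²ε/(δ|X|).

open import Defs
open import Data.Nat as ℕ using (ℕ; zero; suc; s≤s; z≤n)
import Data.Nat.Properties as ℕP
import Data.Integer as ℤ
import Data.Integer.Properties as ℤP
import Data.Nat.Coprimality as Coprime
open import Data.Rational
open import Data.Rational.Properties
open import Data.Rational.Solver using (module +-*-Solver)
open +-*-Solver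
open import Data.Bool using (Bool; true; false; if_then_else_)
open import Data.Fin using (Fin; zero; suc)
open import Data.Vec using ([]; _∷_; lookup)
open import Data.Fin.Subset using (Subset) renaming (∣_∣ to card)
open import Data.Fin.Subset.Properties using (∣p∣≤n)
open import Data.Product using (_,_; proj₁; proj₂)
open import Data.Sum using (inj₁; inj₂)
open import Relation.Binary.PropositionalEquality

sum-cong : ∀ n {f g : Fin n → ℚ} → (∀ i → f i ≡ g i) → sumℚ n f ≡ sumℚ n g
sum-cong zero    h = refl
sum-cong (suc n) h = cong₂ _+_ (h zero) (sum-cong n (λ i → h (suc i)))

sum-zero : ∀ n → sumℚ n (λ _ → 0ℚ) ≡ 0ℚ
sum-zero zero    = refl
sum-zero (suc n) = trans (+-identityˡ _) (sum-zero n)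

sum-+ : ∀ n (f g : Fin n → ℚ) → sumℚ n (λ i → f i + g i) ≡ sumℚ n f + sumℚ n g
sum-+ zero    f g = refl
sum-+ (suc n) f g =
  trans (cong ((f zero + g zero) +_) (sum-+ n (λ i → f (suc i)) (λ i → g (suc i))))
        (solve 4 (λ a b c d → (a :+ b) :+ (c :+ d) := (a :+ c) :+ (b :+ d)) refl
               (f zero) (g zero) (sumℚ n (λ i → f (suc i))) (sumℚ n (λ i → g (suc i))))

sum-- : ∀ n (f g : Fin n → ℚ) → sumℚ n (λ i → f i - g i) ≡ sumℚ n f - sumℚ n g
sum-- zero    f g = refl
sum-- (suc n) f g =
  trans (cong ((f zero - g zero) +_) (sum-- n (λ i → f (suc i)) (λ i → g (suc i))))
        (solve 4 (λ a b c d → (a :- b) :+ (c :- d) := (a :+ c) :- (b :+ d)) refl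
               (f zero) (g zero) (sumℚ n (λ i → f (suc i))) (sumℚ n (λ i → g (suc i))))

sum-*ˡ : ∀ n c (f : Fin n → ℚ) → sumℚ n (λ i → c * f i) ≡ c * sumℚ n f
sum-*ˡ zero    c f = sym (*-zeroʳ c)
sum-*ˡ (suc n) c f =
  trans (cong (c * f zero +_) (sum-*ˡ n c (λ i → f (suc i)))) (sym (*-distribˡ-+ c _ _))

sum-*ʳ : ∀ n c (f : Fin n → ℚ) → sumℚ n (λ i → f i * c) ≡ sumℚ n f * c
sum-*ʳ n c f = trans (sum-cong n (λ i → *-comm (f i) c)) (trans (sum-*ˡ n c f) (*-comm c _))

sum-swap : ∀ n m (f : Fin n → Fin m → ℚ) →
  sumℚ n (λ i → sumℚ m (f i)) ≡ sumℚ m (λ j → sumℚ n (λ i → f i j))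
sum-swap zero    m f = sym (sum-zero m)
sum-swap (suc n) m f =
  trans (cong (sumℚ m (f zero) +_) (sum-swap n m (λ i → f (suc i)))) (sym (sum-+ m _ _))

toℚ-mkℚ : ∀ n → toℚ n ≡ mkℚ (ℤ.+ n) 0 (Coprime.sym (Coprime.1-coprimeTo n))
toℚ-mkℚ n = normalize-coprime (Coprime.sym (Coprime.1-coprimeTo n))

toℚ-suc : ∀ n → toℚ (suc n) ≡ 1ℚ + toℚ n
toℚ-suc n = trans (/-cong (sym (cong (ℤ._+_ (ℤ.+ 1)) (ℤP.*-identityʳ (ℤ.+ n)))) refl)
                  (cong (1ℚ +_) (sym (toℚ-mkℚ n)))

sum-const : ∀ n c → sumℚ n (λ _ → c) ≡ toℚ n * c
sum-const zero    c = sym (*-zeroˡ c)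
sum-const (suc n) c = begin
  c + sumℚ n (λ _ → c)  ≡⟨ cong (c +_) (sum-const n c) ⟩
  c + toℚ n * c         ≡⟨ solve 2 (λ a b → a :+ b :* a := (con 1ℚ :+ b) :* a) refl c (toℚ n) ⟩
  (1ℚ + toℚ n) * c      ≡⟨ cong (_* c) (sym (toℚ-suc n)) ⟩
  toℚ (suc n) * c       ∎
  where open ≡-Reasoning

sum-indicator : ∀ n (f : Fin n → Bool) c →
  sumℚ n (λ i → if f i then c else 0ℚ) ≡ toℚ (countB n f) * c
sum-indicator zero    f c = sym (*-zeroˡ c)
sum-indicator (suc n) f c =
  trans (cong ((if f zero then c else 0ℚ) +_) (sum-indicator n (λ i → f (suc i)) c))
        (head (f zero) (countB n (λ i → f (suc i))))
  where
  head : ∀ t m → (if t then c else 0ℚ) + toℚ m * c ≡ toℚ ((if t then 1 else 0) ℕ.+ m) * c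
  head true  m = trans (cong (c +_) (sym (sum-const m c))) (sum-const (suc m) c)
  head false m = +-identityˡ _

card≡countB : ∀ {n} (S : Subset n) → card S ≡ countB n (lookup S)
card≡countB []          = refl
card≡countB (true ∷ S)  = cong suc (card≡countB S)
card≡countB (false ∷ S) = card≡countB S

sum-mono : ∀ n {f g : Fin n → ℚ} → (∀ i → f i ≤ g i) → sumℚ n f ≤ sumℚ n g
sum-mono zero    h = ≤-refl
sum-mono (suc n) h = +-mono-≤ (h zero) (sum-mono n (λ i → h (suc i)))

sum-nonneg : ∀ n {f : Fin n → ℚ} → (∀ i → 0ℚ ≤ f i) → 0ℚ ≤ sumℚ n f
sum-nonneg n h = ≤-trans (≤-reflexive (sym (sum-zero n))) (sum-mono n h)

sum-abs : ∀ n (f : Fin n → ℚ) → ∣ sumℚ n f ∣ ≤ sumℚ n (λ i → ∣ f i ∣)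
sum-abs zero    f = ≤-refl
sum-abs (suc n) f =
  ≤-trans (∣p+q∣≤∣p∣+∣q∣ (f zero) _) (+-monoʳ-≤ ∣ f zero ∣ (sum-abs n (λ i → f (suc i))))

inv-cancel : ∀ {n} → 1 ℕ.≤ n → toℚ n * inv n ≡ 1ℚ
inv-cancel {suc n} _ = trans (cong₂ _*_ (toℚ-mkℚ (suc n)) inv≡1/) (*-inverseʳ n/1)
  where
  n/1 : ℚ
  n/1 = mkℚ (ℤ.+ suc n) 0 (Coprime.sym (Coprime.1-coprimeTo (suc n)))
  inv≡1/ : inv (suc n) ≡ 1/ n/1
  inv≡1/ = normalize-coprime (Coprime.1-coprimeTo (suc n))

toℚ-nonneg : ∀ n → 0ℚ ≤ toℚ n
toℚ-nonneg n = nonNegative⁻¹ _ {{normalize-nonNeg n 1}}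

toℚ-mono : ∀ {m n} → m ℕ.≤ n → toℚ m ≤ toℚ n
toℚ-mono {n = n} z≤n = toℚ-nonneg n
toℚ-mono {suc m} {suc n} (s≤s m≤n) =
  subst₂ _≤_ (sym (toℚ-suc m)) (sym (toℚ-suc n)) (+-monoʳ-≤ 1ℚ (toℚ-mono m≤n))

inv-nonneg : ∀ n → 0ℚ ≤ inv n
inv-nonneg zero    = ≤-refl
inv-nonneg (suc n) = nonNegative⁻¹ _ {{normalize-nonNeg 1 (suc n)}}

inv-pos : ∀ {n} → 1 ℕ.≤ n → 0ℚ < inv n
inv-pos {suc n} _ = positive⁻¹ _ {{normalize-pos 1 (suc n)}}

sum-uniform : ∀ {n} → 1 ℕ.≤ n → sumℚ n (uniformVec n) ≡ 1ℚ
sum-uniform {n} n≥1 = trans (sum-const n (inv n)) (inv-cancel n≥1)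

normSq-uniform : ∀ n → normSq (uniformVec n) ≡ inv n
normSq-uniform zero    = refl
normSq-uniform (suc n) = begin
  sumℚ (suc n) (λ _ → i * i)  ≡⟨ sum-const (suc n) (i * i) ⟩
  toℚ (suc n) * (i * i)       ≡⟨ sym (*-assoc (toℚ (suc n)) i i) ⟩
  toℚ (suc n) * i * i         ≡⟨ cong (_* i) (inv-cancel {suc n} (s≤s z≤n)) ⟩
  1ℚ * i                      ≡⟨ *-identityˡ i ⟩
  i                           ∎
  where
  open ≡-Reasoning
  i = inv (suc n)

*-nonneg : ∀ {a b} → 0ℚ ≤ a → 0ℚ ≤ b → 0ℚ ≤ a * b
*-nonneg {a} {b} a≥0 b≥0 = subst (_≤ a * b) (*-zeroʳ a) (*-monoˡ-≤-nonNeg a {{nonNegative a≥0}} b≥0)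

*-mono-left : ∀ {r a b} → 0ℚ ≤ r → a ≤ b → r * a ≤ r * b
*-mono-left {r} r≥0 = *-monoˡ-≤-nonNeg r {{nonNegative r≥0}}

*-mono-right : ∀ {r a b} → 0ℚ ≤ r → a ≤ b → a * r ≤ b * r
*-mono-right {r} r≥0 = *-monoʳ-≤-nonNeg r {{nonNegative r≥0}}

sq≡sq-abs : ∀ p → p * p ≡ ∣ p ∣ * ∣ p ∣
sq≡sq-abs p with ∣p∣≡p∨∣p∣≡-p p
... | inj₁ ∣p∣≡p  = cong₂ _*_ (sym ∣p∣≡p) (sym ∣p∣≡p)
... | inj₂ ∣p∣≡-p =
  trans (solve 1 (λ p → p :* p := (:- p) :* (:- p)) refl p) (cong₂ _*_ (sym ∣p∣≡-p) (sym ∣p∣≡-p))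

sq-nonneg : ∀ p → 0ℚ ≤ p * p
sq-nonneg p = subst (0ℚ ≤_) (sym (sq≡sq-abs p)) (*-nonneg (0≤∣p∣ p) (0≤∣p∣ p))

minus-nonneg-≤ : ∀ {x y} → 0ℚ ≤ y → x - y ≤ x
minus-nonneg-≤ {x} y≥0 = subst (x - _ ≤_) (+-identityʳ x) (+-monoʳ-≤ x (neg-antimono-≤ y≥0))

dist-unit-interval : ∀ {a b} → 0ℚ ≤ a → a ≤ 1ℚ → 0ℚ ≤ b → b ≤ 1ℚ → ∣ a - b ∣ ≤ 1ℚ
dist-unit-interval {a} {b} a≥0 a≤1 b≥0 b≤1 with ∣p∣≡p∨∣p∣≡-p (a - b)
... | inj₁ eq = subst (_≤ 1ℚ) (sym eq) (≤-trans (minus-nonneg-≤ b≥0) a≤1)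
... | inj₂ eq = subst (_≤ 1ℚ) (sym (trans eq (solve 2 (λ a b → :- (a :- b) := b :- a) refl a b)))
                      (≤-trans (minus-nonneg-≤ a≥0) b≤1)

record IsStochastic {p q : ℕ} (K : Kernel p q) : Set where
  field
    nonneg : ∀ a b → 0ℚ ≤ K a b
    rowSum : ∀ a → sumℚ q (K a) ≡ 1ℚ

push : ∀ {p q} → Kernel p q → (Fin p → ℚ) → Fin q → ℚ
push {p} K f c = sumℚ p (λ a → K a c * f a)

restrict : ∀ {p q} → Kernel p q → Subset p → Kernel p q
restrict K S a b = if lookup S a then K a b else 0ℚ

restrict-nonneg : ∀ {p q} {K : Kernel p q} (S : Subset p) →
  (∀ a b → 0ℚ ≤ K a b) → ∀ a b → 0ℚ ≤ restrict K S a b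
restrict-nonneg S K≥0 a b with lookup S a
... | true  = K≥0 a b
... | false = ≤-refl

restrict-≤ : ∀ {p q} {K : Kernel p q} (S : Subset p) →
  (∀ a b → 0ℚ ≤ K a b) → ∀ a b → restrict K S a b ≤ K a b
restrict-≤ S K≥0 a b with lookup S a
... | true  = ≤-refl
... | false = K≥0 a b

walk-compose : ∀ {p w q} (K₁ : Kernel p w) (K₂ : Kernel w q) (S : Subset p) c →
  walkDist (composeK K₁ K₂) S c ≡ push K₂ (walkDist K₁ S) c
walk-compose {p} {w} K₁ K₂ S c = begin
  iS * sumℚ p (λ a → restrict (composeK K₁ K₂) S a c)
    ≡⟨ cong (iS *_) (sum-cong p restrict-compose) ⟩
  iS * sumℚ p (λ a → sumℚ w (λ b → R a b * K₂ b c))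
    ≡⟨ cong (iS *_) (sum-swap p w (λ a b → R a b * K₂ b c)) ⟩
  iS * sumℚ w (λ b → sumℚ p (λ a → R a b * K₂ b c))
    ≡⟨ cong (iS *_) (sum-cong w (λ b → sum-*ʳ p (K₂ b c) (λ a → R a b))) ⟩
  iS * sumℚ w (λ b → column b * K₂ b c)
    ≡⟨ sym (sum-*ˡ w iS (λ b → column b * K₂ b c)) ⟩
  sumℚ w (λ b → iS * (column b * K₂ b c))
    ≡⟨ sum-cong w (λ b → solve 3 (λ i s k → i :* (s :* k) := k :* (i :* s)) refl iS (column b) (K₂ b c)) ⟩
  push K₂ (walkDist K₁ S) c ∎
  where
  open ≡-Reasoning
  iS = inv (card S)
  R = restrict K₁ S
  column : Fin w → ℚ
  column b = sumℚ p (λ a → R a b)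
  restrict-compose : ∀ a → restrict (composeK K₁ K₂) S a c ≡ sumℚ w (λ b → R a b * K₂ b c)
  restrict-compose a with lookup S a
  ... | true  = refl
  ... | false = sym (trans (sum-cong w (λ b → *-zeroˡ (K₂ b c))) (sum-zero w))

walk-nonneg : ∀ {p q} {K : Kernel p q} (S : Subset p) →
  (∀ a b → 0ℚ ≤ K a b) → ∀ b → 0ℚ ≤ walkDist K S b
walk-nonneg {p} S K≥0 b =
  *-nonneg (inv-nonneg (card S)) (sum-nonneg p (λ a → restrict-nonneg S K≥0 a b))

walk-≤-column : ∀ {p q} {K : Kernel p q} (S : Subset p) →
  (∀ a b → 0ℚ ≤ K a b) → ∀ b → walkDist K S b ≤ inv (card S) * sumℚ p (λ a → K a b)
walk-≤-column {p} S K≥0 b =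
  *-mono-left (inv-nonneg (card S)) (sum-mono p (λ a → restrict-≤ S K≥0 a b))

walk-sum : ∀ {p q} {K : Kernel p q} (S : Subset p) → IsStochastic K →
  1 ℕ.≤ card S → sumℚ q (walkDist K S) ≡ 1ℚ
walk-sum {p} {q} {K} S stoch S≢∅ = begin
  sumℚ q (λ b → iS * sumℚ p (λ a → R a b))  ≡⟨ sum-*ˡ q iS (λ b → sumℚ p (λ a → R a b)) ⟩
  iS * sumℚ q (λ b → sumℚ p (λ a → R a b))  ≡⟨ cong (iS *_) (sym (sum-swap p q R)) ⟩
  iS * sumℚ p (λ a → sumℚ q (R a))          ≡⟨ cong (iS *_) (sum-cong p rowMass) ⟩
  iS * sumℚ p (λ a → if lookup S a then 1ℚ else 0ℚ)
    ≡⟨ cong (iS *_) (sum-indicator p (lookup S) 1ℚ) ⟩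
  iS * (toℚ (countB p (lookup S)) * 1ℚ)    ≡⟨ cong (λ n → iS * (toℚ n * 1ℚ)) (sym (card≡countB S)) ⟩
  iS * (toℚ (card S) * 1ℚ)                  ≡⟨ cong (iS *_) (*-identityʳ _) ⟩
  iS * toℚ (card S)                         ≡⟨ *-comm iS _ ⟩
  toℚ (card S) * iS                         ≡⟨ inv-cancel S≢∅ ⟩
  1ℚ                                        ∎
  where
  open ≡-Reasoning
  open IsStochastic stoch
  iS = inv (card S)
  R = restrict K S
  rowMass : ∀ a → sumℚ q (R a) ≡ (if lookup S a then 1ℚ else 0ℚ)
  rowMass a with lookup S a
  ... | true  = rowSum a
  ... | false = sum-zero q

push-sub : ∀ {p q} (K : Kernel p q) (f g : Fin p → ℚ) c →
  push K (λ a → f a - g a) c ≡ push K f c - push K g c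
push-sub {p} K f g c =
  trans (sum-cong p (λ a → solve 3 (λ k x y → k :* (x :- y) := k :* x :- k :* y) refl (K a c) (f a) (g a)))
        (sum-- p (λ a → K a c * f a) (λ a → K a c * g a))

push-l1 : ∀ {p q} {K : Kernel p q} → IsStochastic K → (f : Fin p → ℚ) →
  sumℚ q (λ c → ∣ push K f c ∣) ≤ sumℚ p (λ a → ∣ f a ∣)
push-l1 {p} {q} {K} stoch f = begin
  sumℚ q (λ c → ∣ push K f c ∣)                  ≤⟨ sum-mono q (λ c → sum-abs p (λ a → K a c * f a)) ⟩
  sumℚ q (λ c → sumℚ p (λ a → ∣ K a c * f a ∣)) ≡⟨ sum-cong q (λ c → sum-cong p (λ a → abs-product a c)) ⟩
  sumℚ q (λ c → sumℚ p (λ a → K a c * ∣ f a ∣)) ≡⟨ sum-swap q p (λ c a → K a c * ∣ f a ∣) ⟩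
  sumℚ p (λ a → sumℚ q (λ c → K a c * ∣ f a ∣)) ≡⟨ sum-cong p (λ a → sum-*ʳ q ∣ f a ∣ (K a)) ⟩
  sumℚ p (λ a → sumℚ q (K a) * ∣ f a ∣)         ≡⟨ sum-cong p (λ a → trans (cong (_* ∣ f a ∣) (rowSum a)) (*-identityˡ _)) ⟩
  sumℚ p (λ a → ∣ f a ∣)                         ∎
  where
  open ≤-Reasoning
  open IsStochastic stoch
  abs-product : ∀ a c → ∣ K a c * f a ∣ ≡ K a c * ∣ f a ∣
  abs-product a c = trans (∣p*q∣≡∣p∣*∣q∣ (K a c) (f a)) (cong (_* ∣ f a ∣) (0≤p⇒∣p∣≡p (nonneg a c)))

dev : ∀ {q} → (Fin q → ℚ) → Fin q → ℚ
dev {q} π b = π b - inv q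

dev-push : ∀ {p q} (K : Kernel p q) → (∀ c → push K (uniformVec p) c ≡ inv q) →
  (f : Fin p → ℚ) → ∀ c → dev (push K f) c ≡ push K (dev f) c
dev-push K uniform↦uniform f c =
  sym (trans (push-sub K f (uniformVec _) c) (cong (_-_ (push K f c)) (uniform↦uniform c)))

dev-sum : ∀ {q} → 1 ℕ.≤ q → (π : Fin q → ℚ) → sumℚ q π ≡ 1ℚ → sumℚ q (dev π) ≡ 0ℚ
dev-sum {q} q≥1 π mass1 =
  trans (sum-- q π (uniformVec q)) (trans (cong₂ _-_ mass1 (sum-uniform q≥1)) (+-inverseʳ 1ℚ))

-- ‖f‖² ≤ |f|₁ · max|f|, in the form: if every |f b| is at most 1/s then ‖f‖²·s ≤ |f|₁.
normSq-≤-l1 : ∀ {n} {s : ℚ} (f : Fin n → ℚ) → 0ℚ ≤ s → (∀ b → ∣ f b ∣ * s ≤ 1ℚ) →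
  normSq f * s ≤ sumℚ n (λ b → ∣ f b ∣)
normSq-≤-l1 {n} {s} f s≥0 bounded =
  ≤-trans (≤-reflexive (sym (sum-*ʳ n s (λ b → f b * f b)))) (sum-mono n term)
  where
  open ≤-Reasoning
  term : ∀ b → f b * f b * s ≤ ∣ f b ∣
  term b = begin
    f b * f b * s              ≡⟨ cong (_* s) (sq≡sq-abs (f b)) ⟩
    ∣ f b ∣ * ∣ f b ∣ * s      ≡⟨ *-assoc ∣ f b ∣ _ _ ⟩
    ∣ f b ∣ * (∣ f b ∣ * s)    ≤⟨ *-mono-left (0≤∣p∣ (f b)) (bounded b) ⟩
    ∣ f b ∣ * 1ℚ               ≡⟨ *-identityʳ _ ⟩
    ∣ f b ∣                    ∎

Fin⇒1≤ : ∀ {n} → Fin n → 1 ℕ.≤ n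
Fin⇒1≤ {suc n} _ = s≤s z≤n

sum-of-degrees : ∀ n (deg : Fin n → ℕ) k → (∀ i → deg i ≡ k) →
  sumℚ n (λ i → toℚ (deg i) * 1ℚ) ≡ toℚ n * toℚ k
sum-of-degrees n deg k regular =
  trans (sum-cong n (λ i → cong (λ m → toℚ m * 1ℚ) (regular i)))
        (trans (sum-const n (toℚ k * 1ℚ)) (cong (toℚ n *_) (*-identityʳ (toℚ k))))

cross-multiply : ∀ {a b m n m⁻¹ n⁻¹ : ℚ} → m * m⁻¹ ≡ 1ℚ → n * n⁻¹ ≡ 1ℚ →
  a * m ≡ b * n → b * m⁻¹ ≡ a * n⁻¹
cross-multiply {a} {b} {m} {n} {m⁻¹} {n⁻¹} mm⁻¹≡1 nn⁻¹≡1 am≡bn = begin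
  b * m⁻¹                     ≡⟨ sym (*-identityʳ _) ⟩
  b * m⁻¹ * 1ℚ                ≡⟨ cong (b * m⁻¹ *_) (sym nn⁻¹≡1) ⟩
  b * m⁻¹ * (n * n⁻¹)         ≡⟨ solve 4 (λ b i n j → b :* i :* (n :* j) := b :* n :* i :* j) refl b m⁻¹ n n⁻¹ ⟩
  b * n * m⁻¹ * n⁻¹           ≡⟨ cong (λ t → t * m⁻¹ * n⁻¹) (sym am≡bn) ⟩
  a * m * m⁻¹ * n⁻¹           ≡⟨ solve 4 (λ a m i j → a :* m :* i :* j := a :* j :* (m :* i)) refl a m m⁻¹ n⁻¹ ⟩
  a * n⁻¹ * (m * m⁻¹)         ≡⟨ cong (a * n⁻¹ *_) mm⁻¹≡1 ⟩
  a * n⁻¹ * 1ℚ                ≡⟨ *-identityʳ _ ⟩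
  a * n⁻¹                     ∎
  where open ≡-Reasoning

module BiRegular {p q : ℕ} (E : BipGraph p q) (reg : IsBiRegular E) where

  D D' : ℕ
  D  = proj₁ reg
  D' = proj₁ (proj₂ reg)

  D≥1 : 1 ℕ.≤ D
  D≥1 = proj₁ (proj₂ (proj₂ reg))

  leftDeg : ∀ a → degL E a ≡ D
  leftDeg = proj₁ (proj₂ (proj₂ (proj₂ (proj₂ reg))))

  rightDeg : ∀ b → degR E b ≡ D'
  rightDeg = proj₂ (proj₂ (proj₂ (proj₂ (proj₂ reg))))

  K : Kernel p q
  K = graphKernel E

  K-on-edges : ∀ a b → K a b ≡ (if E a b then inv D else 0ℚ)
  K-on-edges a b = cong (λ n → if E a b then inv n else 0ℚ) (leftDeg a)

  stochastic : IsStochastic K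
  stochastic = record { nonneg = nonneg ; rowSum = rowSum }
    where
    nonneg : ∀ a b → 0ℚ ≤ K a b
    nonneg a b with E a b
    ... | true  = inv-nonneg (degL E a)
    ... | false = ≤-refl
    rowSum : ∀ a → sumℚ q (K a) ≡ 1ℚ
    rowSum a = begin
      sumℚ q (K a)                                 ≡⟨ sum-cong q (K-on-edges a) ⟩
      sumℚ q (λ b → if E a b then inv D else 0ℚ)   ≡⟨ sum-indicator q (E a) (inv D) ⟩
      toℚ (degL E a) * inv D                       ≡⟨ cong (λ n → toℚ n * inv D) (leftDeg a) ⟩
      toℚ D * inv D                                ≡⟨ inv-cancel D≥1 ⟩
      1ℚ                                           ∎
      where open ≡-Reasoning

  rightNonempty : Fin p → 1 ℕ.≤ q
  rightNonempty a = ℕP.≤-trans D≥1 (subst (ℕ._≤ q) (leftDeg a) (countB-≤ q (E a)))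
    where
    countB-≤ : ∀ n (f : Fin n → Bool) → countB n f ℕ.≤ n
    countB-≤ zero    f = z≤n
    countB-≤ (suc n) f with f zero
    ... | true  = s≤s (countB-≤ n (λ i → f (suc i)))
    ... | false = ℕP.m≤n⇒m≤1+n (countB-≤ n (λ i → f (suc i)))

  -- Counting edges from both sides: |P|·D = |Q|·D'.
  double-count : toℚ p * toℚ D ≡ toℚ q * toℚ D'
  double-count = begin
    toℚ p * toℚ D                                 ≡⟨ sym (sum-of-degrees p (degL E) D leftDeg) ⟩
    sumℚ p (λ a → toℚ (degL E a) * 1ℚ)            ≡⟨ sum-cong p (λ a → sym (sum-indicator q (E a) 1ℚ)) ⟩
    sumℚ p (λ a → sumℚ q (λ b → edge a b))        ≡⟨ sum-swap p q edge ⟩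
    sumℚ q (λ b → sumℚ p (λ a → edge a b))        ≡⟨ sum-cong q (λ b → sum-indicator p (λ a → E a b) 1ℚ) ⟩
    sumℚ q (λ b → toℚ (degR E b) * 1ℚ)            ≡⟨ sum-of-degrees q (degR E) D' rightDeg ⟩
    toℚ q * toℚ D'                                ∎
    where
    open ≡-Reasoning
    edge : Fin p → Fin q → ℚ
    edge a b = if E a b then 1ℚ else 0ℚ

  colSum : ∀ b → sumℚ p (λ a → K a b) ≡ toℚ p * inv q
  colSum b = begin
    sumℚ p (λ a → K a b)                           ≡⟨ sum-cong p (λ a → K-on-edges a b) ⟩
    sumℚ p (λ a → if E a b then inv D else 0ℚ)     ≡⟨ sum-indicator p (λ a → E a b) (inv D) ⟩
    toℚ (degR E b) * inv D                         ≡⟨ cong (λ n → toℚ n * inv D) (rightDeg b) ⟩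
    toℚ D' * inv D                                 ≡⟨ cross-multiply {toℚ p} {toℚ D'} {toℚ D} {toℚ q} (inv-cancel D≥1) (inv-cancel (Fin⇒1≤ b))
                                                             (trans double-count (*-comm (toℚ q) (toℚ D'))) ⟩
    toℚ p * inv q                                  ∎
    where open ≡-Reasoning

  preservesUniform : 1 ℕ.≤ p → ∀ b → push K (uniformVec p) b ≡ inv q
  preservesUniform p≥1 b = begin
    sumℚ p (λ a → K a b * inv p)     ≡⟨ sum-*ʳ p (inv p) (λ a → K a b) ⟩
    sumℚ p (λ a → K a b) * inv p     ≡⟨ cong (_* inv p) (colSum b) ⟩
    toℚ p * inv q * inv p            ≡⟨ solve 3 (λ t i j → t :* i :* j := i :* (t :* j)) refl (toℚ p) (inv q) (inv p) ⟩
    inv q * (toℚ p * inv p)          ≡⟨ cong (inv q *_) (inv-cancel p≥1) ⟩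
    inv q * 1ℚ                       ≡⟨ *-identityʳ _ ⟩
    inv q                            ∎
    where open ≡-Reasoning

rescale : ∀ {N n L ε δ tW iW iX : ℚ} (δ>0 : 0ℚ < δ) → 0ℚ < iW → tW * iW ≡ 1ℚ →
  0ℚ ≤ L → 0ℚ ≤ iX → N * iW ≤ L * (n * iX) → n * (δ * tW) ≤ ε →
  N ≤ _÷_ (L * ε) δ {{>-nonZero δ>0}} * iX
rescale {N} {n} {L} {ε} {δ} {tW} {iW} {iX} δ>0 iW>0 tW*iW≡1 L≥0 iX≥0 expand ℓ₂≤ℓ₁ =
  *-cancelʳ-≤-pos (iW * δ) {{pos*pos⇒pos iW {{positive iW>0}} δ {{positive δ>0}}}} chain
  where
  instance
    δ≢0 : NonZero δ
    δ≢0 = >-nonZero δ>0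
  coefficient≥0 : 0ℚ ≤ L * iX * iW
  coefficient≥0 = *-nonneg (*-nonneg L≥0 iX≥0) (<⇒≤ iW>0)
  chain : N * (iW * δ) ≤ ((L * ε) ÷ δ) * iX * (iW * δ)
  chain = begin
    N * (iW * δ)                   ≡⟨ sym (*-assoc N iW δ) ⟩
    N * iW * δ                     ≤⟨ *-mono-right (<⇒≤ δ>0) expand ⟩
    L * (n * iX) * δ               ≡⟨ sym (*-identityʳ _) ⟩
    L * (n * iX) * δ * 1ℚ          ≡⟨ cong (L * (n * iX) * δ *_) (sym tW*iW≡1) ⟩
    L * (n * iX) * δ * (tW * iW)   ≡⟨ solve 6 (λ L n iX δ tW iW → L :* (n :* iX) :* δ :* (tW :* iW)
                                                              := L :* iX :* iW :* (n :* (δ :* tW)))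
                                            refl L n iX δ tW iW ⟩
    L * iX * iW * (n * (δ * tW))   ≤⟨ *-mono-left coefficient≥0 ℓ₂≤ℓ₁ ⟩
    L * iX * iW * ε                ≡⟨ sym (*-identityʳ _) ⟩
    L * iX * iW * ε * 1ℚ           ≡⟨ cong (L * iX * iW * ε *_) (sym (*-inverseʳ δ)) ⟩
    L * iX * iW * ε * (δ * 1/ δ)   ≡⟨ solve 6 (λ L iX iW ε δ δ⁻¹ → L :* iX :* iW :* ε :* (δ :* δ⁻¹)
                                                                := L :* ε :* δ⁻¹ :* iX :* (iW :* δ))
                                            refl L iX iW ε δ (1/ δ) ⟩
    ((L * ε) ÷ δ) * iX * (iW * δ)  ∎
    where open ≤-Reasoning

module ProductWalk {v w x : ℕ} (E₁ : BipGraph v w) (E₂ : BipGraph w x)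
  (reg₁ : IsBiRegular E₁) (reg₂ : IsBiRegular E₂)
  (δ : ℚ) (δ>0 : 0ℚ < δ)
  (S : Subset v) (S≢∅ : 1 ℕ.≤ card S) (S-large : δ * toℚ v ≤ toℚ (card S)) where

  module H₁ = BiRegular E₁ reg₁
  module H₂ = BiRegular E₂ reg₂

  π₁ : Fin w → ℚ
  π₁ = walkDist (graphKernel E₁) S

  π : Fin x → ℚ
  π = walkDist (productKernel E₁ E₂) S

  d : Fin w → ℚ
  d = dev π₁

  v≥1 : 1 ℕ.≤ v
  v≥1 = ℕP.≤-trans S≢∅ (∣p∣≤n S)

  w≥1 : 1 ℕ.≤ w
  w≥1 = H₁.rightNonempty (elementOf v≥1)
    where
    elementOf : ∀ {n} → 1 ℕ.≤ n → Fin n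
    elementOf {suc n} _ = zero

  dev-π : ∀ c → dev π c ≡ applyH E₂ d c
  dev-π c = trans (cong (_- inv x) (walk-compose (graphKernel E₁) (graphKernel E₂) S c))
                  (dev-push H₂.K (H₂.preservesUniform w≥1) π₁ c)

  l1-contracts : l1dist π ≤ l1dist π₁
  l1-contracts =
    subst (_≤ l1dist π₁) (sum-cong x (λ c → cong ∣_∣ (sym (dev-π c)))) (push-l1 H₂.stochastic d)

  -- Coordinates of π₁ and u_W are at most 1/scale.
  scale : ℚ
  scale = δ * toℚ w

  scale≥0 : 0ℚ ≤ scale
  scale≥0 = *-nonneg (<⇒≤ δ>0) (toℚ-nonneg w)

  δ≤1 : δ ≤ 1ℚ
  δ≤1 = *-cancelʳ-≤-pos (toℚ v) {{positive (<-≤-trans (positive⁻¹ 1ℚ) (toℚ-mono v≥1))}}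
          (≤-trans S-large (subst (toℚ (card S) ≤_) (sym (*-identityˡ (toℚ v))) (toℚ-mono (∣p∣≤n S))))

  π₁-scaled : ∀ b → π₁ b * scale ≤ 1ℚ
  π₁-scaled b = begin
    π₁ b * (δ * tW)                ≤⟨ *-mono-right scale≥0 (walk-≤-column S (IsStochastic.nonneg H₁.stochastic) b) ⟩
    iS * sumℚ v (λ a → H₁.K a b) * (δ * tW)
                                   ≡⟨ cong (λ t → iS * t * (δ * tW)) (H₁.colSum b) ⟩
    iS * (tv * iW) * (δ * tW)      ≡⟨ solve 5 (λ iS tv iW δ tW → iS :* (tv :* iW) :* (δ :* tW)
                                                                  := iS :* (δ :* tv) :* (tW :* iW))
                                             refl iS tv iW δ tW ⟩
    iS * (δ * tv) * (tW * iW)      ≡⟨ cong (iS * (δ * tv) *_) (inv-cancel w≥1) ⟩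
    iS * (δ * tv) * 1ℚ             ≡⟨ *-identityʳ _ ⟩
    iS * (δ * tv)                  ≤⟨ *-mono-left (inv-nonneg (card S)) S-large ⟩
    iS * toℚ (card S)              ≡⟨ *-comm iS _ ⟩
    toℚ (card S) * iS              ≡⟨ inv-cancel S≢∅ ⟩
    1ℚ                             ∎
    where
    open ≤-Reasoning
    iS = inv (card S)
    iW = inv w
    tW = toℚ w
    tv = toℚ v

  uniform-scaled : inv w * scale ≤ 1ℚ
  uniform-scaled = ≤-trans (≤-reflexive iW*scale≡δ) δ≤1
    where
    iW*scale≡δ : inv w * scale ≡ δ
    iW*scale≡δ = trans (solve 3 (λ i δ t → i :* (δ :* t) := δ :* (t :* i)) refl (inv w) δ (toℚ w))
                       (trans (cong (δ *_) (inv-cancel w≥1)) (*-identityʳ δ))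

  d-scaled : ∀ b → ∣ d b ∣ * scale ≤ 1ℚ
  d-scaled b = subst (_≤ 1ℚ) scaled-dev
    (dist-unit-interval (*-nonneg (walk-nonneg S (IsStochastic.nonneg H₁.stochastic) b) scale≥0)
                        (π₁-scaled b) (*-nonneg (inv-nonneg w) scale≥0) uniform-scaled)
    where
    scaled-dev : ∣ π₁ b * scale - inv w * scale ∣ ≡ ∣ d b ∣ * scale
    scaled-dev = begin
      ∣ π₁ b * scale - inv w * scale ∣  ≡⟨ cong ∣_∣ (solve 3 (λ a c s → a :* s :- c :* s := (a :- c) :* s) refl (π₁ b) (inv w) scale) ⟩
      ∣ d b * scale ∣                   ≡⟨ ∣p*q∣≡∣p∣*∣q∣ (d b) scale ⟩
      ∣ d b ∣ * ∣ scale ∣               ≡⟨ cong (∣ d b ∣ *_) (0≤p⇒∣p∣≡p scale≥0) ⟩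
      ∣ d b ∣ * scale                   ∎
      where open ≡-Reasoning

  normSq-d : normSq d * scale ≤ l1dist π₁
  normSq-d = normSq-≤-l1 d scale≥0 d-scaled

  -- The expander inequality for d, with ‖u_W‖² = 1/|W| and ‖H₂u_W‖² = 1/|X|.
  expander-step : ∀ {λ'} → IsExpander E₂ λ' → l2distSq π * inv w ≤ (λ' * λ') * (normSq d * inv x)
  expander-step {λ'} expander = begin
    l2distSq π * inv w
      ≡⟨ cong₂ _*_ (sum-cong x (λ c → cong₂ _*_ (dev-π c) (dev-π c))) (sym (normSq-uniform w)) ⟩
    normSq (applyH E₂ d) * normSq (uniformVec w)
      ≤⟨ proj₂ (expander d (dev-sum w≥1 π₁ (walk-sum S H₁.stochastic S≢∅))) ⟩
    (λ' * λ') * (normSq d * normSq (applyH E₂ (uniformVec w)))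
      ≡⟨ cong (λ t → (λ' * λ') * (normSq d * t)) H₂u-normSq ⟩
    (λ' * λ') * (normSq d * inv x) ∎
    where
    open ≤-Reasoning
    H₂u-normSq : normSq (applyH E₂ (uniformVec w)) ≡ inv x
    H₂u-normSq = trans (sum-cong x (λ c → cong₂ _*_ (H₂.preservesUniform w≥1 c) (H₂.preservesUniform w≥1 c)))
                       (normSq-uniform x)

mainTheorem2 : {v w x : ℕ} → (E₁ : BipGraph v w) → (E₂ : BipGraph w x) →
    (δ ε λ' : ℚ) → (δ>0 : 0ℚ < δ) →
    IsBiRegular E₁ → IsExtractor E₁ δ ε →
    IsBiRegular E₂ → IsExpander E₂ λ' →
    IsFortifierK (productKernel E₁ E₂) δ ε
      (_÷_ ((λ' * λ') * ε) δ {{>-nonZero δ>0}})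
mainTheorem2 {w = w} {x = x} E₁ E₂ δ ε λ' δ>0 reg₁ extractor reg₂ expander S S≢∅ S-large =
  ≤-trans l1-contracts π₁-close ,
  rescale {n = normSq d} {tW = toℚ w} δ>0 (inv-pos w≥1) (inv-cancel w≥1) (sq-nonneg λ') (inv-nonneg x)
          (expander-step expander) (≤-trans normSq-d π₁-close)
  where
  open ProductWalk E₁ E₂ reg₁ reg₂ δ δ>0 S S≢∅ S-large
  π₁-close : l1dist π₁ ≤ ε
  π₁-close = extractor S S≢∅ S-large
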